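{- The game $\langle P_n, h, g\rangle$, where $h$ is the function constantly equal to $4s-1$ and $g$ is the function constantly equal to $s$, is losing for all $n$.
   Context: Hat guessing game $\langle G, h, g\rangle$: a sage sits at each vertex $v$ of the graph $G$; an adversary puts on the head of each sage $v$ a hat whose color is chosen from $\{0,1,\dots,h(v)-1\}$; each sage sees the hat colors of his neighbours but not his own; without communication, each sage $v$ names a list of $g(v)$ colors, determined by a deterministic strategy (fixed in advance and known to the adversary) from the colors he sees. The game is winning if there is a strategy guaranteeing that for every hat assignment at least one sage's list contains his own hat color; otherwise it is losing. $P_n$ is the path on $n$ vertices, $s\ge 1$ an integer. -}

module Defs where

open import Data.Nat using (ℕ; suc; _∸_; _*_)
open import Data.Fin using (Fin; toℕ)
open import Data.Fin.Subset using (Subset; ∣_∣; _∈_)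
open import Data.Product using (Σ; ∃; _×_)
open import Relation.Binary.PropositionalEquality using (_≡_)
open import Data.Sum using (_⊎_)
open import Relation.Nullary using (¬_)
open import Level using (0ℓ)

record Graph (n : ℕ) : Set₁ where
  field
    Adj : Fin n → Fin n → Set

PathGraph : (n : ℕ) → Graph n
PathGraph n = record { Adj = λ i j → (toℕ j ≡ suc (toℕ i)) ⊎ (toℕ i ≡ suc (toℕ j)) }

Assignment : {n : ℕ} → (h : Fin n → ℕ) → Set
Assignment {n} h = (v : Fin n) → Fin (h v)

-- Strategy of the game ⟨G, h, g⟩: each sage v names a set of exactly g v colors
-- (a list of g v colors), which is a function of the hat assignment depending
-- only on the colors of the neighbours of v (the sage sees only his neighbours).
record Strategy {n : ℕ} (G : Graph n) (h g : Fin n → ℕ) : Set₁ where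
  field
    guess : (v : Fin n) → Assignment h → Subset (h v)
    size  : ∀ v c → ∣ guess v c ∣ ≡ g v
    local : ∀ v (c c′ : Assignment h) →
            (∀ u → Graph.Adj G v u → c u ≡ c′ u) → guess v c ≡ guess v c′

Wins : {n : ℕ} {G : Graph n} {h g : Fin n → ℕ} → Strategy G h g → Set
Wins {n} {G} {h} S = (c : Assignment h) → ∃ λ v → c v ∈ Strategy.guess S v c

Winning : {n : ℕ} → Graph n → (h g : Fin n → ℕ) → Set₁
Winning G h g = Σ (Strategy G h g) (λ S → Wins {G = G} {h = h} {g = g} S)

Losing : {n : ℕ} → Graph n → (h g : Fin n → ℕ) → Set₁
Losing G h g = ¬ Winning G h g

-- Scan the path from left to right. Given adjacent vertices u, u + 1 and a colour z for u + 1,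
-- call a colour x good if some colouring with x at u and z at u + 1 makes the sage at u and all
-- sages left of him guess wrong. For every z at least 2s of the 4s − 1 colours are good: x is bad
-- only if the sage at u names x for every colour y of u − 1 that is good for x, and double counting
-- the s guesses of that sage over all y shows that fewer than 2s colours can be bad. So good
-- colours exist up to the right end of the path, where they give a colouring fooling every sage.

module Submission where

open import Defs
open import Data.Nat using (ℕ; zero; suc; _+_; _*_; _∸_; _≤_; _<_; z≤n; s≤s; z<s; _≟_; _<?_)
open import Data.Nat.Properties
open import Data.Nat.Tactic.RingSolver using (solve-∀)
open import Algebra.Properties.Semiring.Sum +-*-semiring
  using (sum-syntax; sum-cong-≗; ∑-comm; ∑-distrib-+; *-distribʳ-sum)
open import Data.Bool using (Bool; true; false; not; T)
open import Data.Bool.Properties using (T?; T-≡)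
open import Data.Fin as Fin using (Fin; toℕ; fromℕ<)
open import Data.Fin.Properties using (any?; toℕ<n; fromℕ<-toℕ)
open import Data.Fin.Subset using (Subset; ∣_∣)
open import Data.Vec using ([]; _∷_; lookup)
open import Data.Vec.Properties using ([]=⇒lookup)
open import Data.Product using (∃; _×_; _,_)
open import Data.Sum using (inj₁; inj₂)
open import Data.Unit using (tt)
open import Function using (_∘_; Equivalence)
open import Relation.Nullary using (¬_; Dec; yes; no; contradiction)
open import Relation.Nullary.Decidable using (⌊_⌋; _×-dec_; ¬?; toWitness; toWitnessFalse; decidable-stable)
open import Relation.Binary.PropositionalEquality

indicator : Bool → ℕ
indicator false = 0
indicator true  = 1

count : ∀ {n} → (Fin n → Bool) → ℕ
count {n} p = ∑[ i < n ] indicator (p i)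

∑-mono-≤ : ∀ {n} {f g : Fin n → ℕ} → (∀ i → f i ≤ g i) → ∑[ i < n ] f i ≤ ∑[ i < n ] g i
∑-mono-≤ {zero}  f≤g = z≤n
∑-mono-≤ {suc n} f≤g = +-mono-≤ (f≤g Fin.zero) (∑-mono-≤ (f≤g ∘ Fin.suc))

∑-const : ∀ n c → ∑[ i < n ] c ≡ n * c
∑-const zero    c = refl
∑-const (suc n) c = cong (c +_) (∑-const n c)

count-true : ∀ n → count {n} (λ _ → true) ≡ n
count-true n = trans (∑-const n 1) (*-identityʳ n)

count+count-not : ∀ {n} (p : Fin n → Bool) → count p + count (not ∘ p) ≡ n
count+count-not {n} p = begin
  count p + count (not ∘ p)
    ≡⟨ ∑-distrib-+ (indicator ∘ p) (indicator ∘ not ∘ p) ⟨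
  ∑[ i < n ] (indicator (p i) + indicator (not (p i)))
    ≡⟨ sum-cong-≗ (λ i → one-of (p i)) ⟩
  count {n} (λ _ → true)
    ≡⟨ count-true n ⟩
  n ∎
  where
  open ≡-Reasoning
  one-of : ∀ b → indicator b + indicator (not b) ≡ 1
  one-of false = refl
  one-of true  = refl

count-mono : ∀ {n} {p q : Fin n → Bool} → (∀ i → T (p i) → T (q i)) → count p ≤ count q
count-mono p⊆q = ∑-mono-≤ (λ i → indicator-mono (p⊆q i))
  where
  indicator-mono : ∀ {b c} → (T b → T c) → indicator b ≤ indicator c
  indicator-mono {false}         _   = z≤n
  indicator-mono {true}  {true}  _   = ≤-refl
  indicator-mono {true}  {false} b⇒c = contradiction tt b⇒c

count-*≤∑ : ∀ {n a} (p : Fin n → Bool) {f : Fin n → ℕ} →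
            (∀ i → T (p i) → a ≤ f i) → count p * a ≤ ∑[ i < n ] f i
count-*≤∑ {n} {a} p {f} a≤f = begin
  count p * a                        ≡⟨ *-distribʳ-sum a (indicator ∘ p) ⟩
  ∑[ i < n ] (indicator (p i) * a)   ≤⟨ ∑-mono-≤ (λ i → weighted (p i) (a≤f i)) ⟩
  ∑[ i < n ] f i                     ∎
  where
  open ≤-Reasoning
  weighted : ∀ b {c} → (T b → a ≤ c) → indicator b * a ≤ c
  weighted false _   = z≤n
  weighted true  a≤c = ≤-trans (≤-reflexive (+-identityʳ a)) (a≤c tt)

count>0⇒∃ : ∀ {n} (p : Fin n → Bool) → 0 < count p → ∃ λ i → T (p i)
count>0⇒∃ {n} p count>0 with any? (T? ∘ p)
... | yes ∃p = ∃p
... | no  ∄p = contradiction count>0 (≤⇒≯ (begin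
  count p                    ≤⟨ count-mono (λ i pi → contradiction (i , pi) ∄p) ⟩
  count {n} (λ _ → false)    ≡⟨ trans (∑-const n 0) (*-zeroʳ n) ⟩
  0                          ∎))
  where open ≤-Reasoning

∣p∣≡count : ∀ {n} (p : Subset n) → ∣ p ∣ ≡ count (lookup p)
∣p∣≡count []          = refl
∣p∣≡count (true ∷ p)  = cong suc (∣p∣≡count p)
∣p∣≡count (false ∷ p) = ∣p∣≡count p

Escapes : ∀ {m n} → (Fin m → Fin n → Bool) → (Fin n → Fin m → Bool) → Fin m → Set
Escapes A G x = ∃ λ y → T (A x y) × ¬ T (G y x)

escapes? : ∀ {m n} (A : Fin m → Fin n → Bool) (G : Fin n → Fin m → Bool) x → Dec (Escapes A G x)
escapes? A G x = any? (λ y → T? (A x y) ×-dec ¬? (T? (G y x)))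

escapes : ∀ {m n} → (Fin m → Fin n → Bool) → (Fin n → Fin m → Bool) → Fin m → Bool
escapes A G x = ⌊ escapes? A G x ⌋

trapped-count : ∀ {m n a g} (A : Fin m → Fin n → Bool) (G : Fin n → Fin m → Bool) →
                (∀ x → a ≤ count (A x)) → (∀ y → count (G y) ≤ g) →
                count (not ∘ escapes A G) * a ≤ n * g
trapped-count {m} {n} {a} {g} A G a≤∣A∣ ∣G∣≤g = begin
  count (not ∘ escapes A G) * a     ≤⟨ count-*≤∑ (not ∘ escapes A G) trapped⇒a≤column ⟩
  ∑[ x < m ] count (λ y → G y x)    ≡⟨ ∑-comm (λ x y → indicator (G y x)) ⟩
  ∑[ y < n ] count (G y)            ≤⟨ ∑-mono-≤ ∣G∣≤g ⟩
  ∑[ y < n ] g                      ≡⟨ ∑-const n g ⟩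
  n * g                             ∎
  where
  open ≤-Reasoning
  trapped⇒a≤column : ∀ x → T (not (escapes A G x)) → a ≤ count (λ y → G y x)
  trapped⇒a≤column x trapped = ≤-trans (a≤∣A∣ x) (count-mono λ y Axy →
    decidable-stable (T? (G y x)) (λ ¬Gyx → toWitnessFalse {a? = escapes? A G x} trapped (y , Axy , ¬Gyx)))

1+h≡4s⇒0<s : ∀ {h s} → suc h ≡ 4 * s → 0 < s
1+h≡4s⇒0<s {s = zero}  ()
1+h≡4s⇒0<s {s = suc _} _ = z<s

1+h≡4s⇒2s≤h : ∀ {h s} → suc h ≡ 4 * s → 2 * s ≤ h
1+h≡4s⇒2s≤h {s = zero}  ()
1+h≡4s⇒2s≤h {h} {s = s@(suc _)} 1+h≡4s = +-cancelʳ-≤ 1 (2 * s) h (begin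
  2 * s + 1       ≤⟨ +-monoʳ-≤ (2 * s) (s≤s z≤n) ⟩
  2 * s + 2 * s   ≡⟨ *-distribʳ-+ s 2 2 ⟨
  4 * s           ≡⟨ 1+h≡4s ⟨
  suc h           ≡⟨ +-comm 1 h ⟩
  h + 1           ∎)
  where open ≤-Reasoning

-- Among h = 4s − 1 elements, t trapped ones of weight 2s each fit into h·s only if t < 2s.
few-trapped : ∀ {h s e t} → suc h ≡ 4 * s → e + t ≡ h → t * (2 * s) ≤ h * s → 2 * s ≤ e
few-trapped {s = zero} ()
few-trapped {h} {s@(suc _)} {e} {t} 1+h≡4s e+t≡h t·2s≤h·s =
  +-cancelʳ-≤ (suc t) (2 * s) e (begin
    2 * s + suc t    ≤⟨ +-monoʳ-≤ (2 * s) t<2s ⟩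
    2 * s + 2 * s    ≡⟨ *-distribʳ-+ s 2 2 ⟨
    4 * s            ≡⟨ 1+h≡4s ⟨
    suc h            ≡⟨ cong suc e+t≡h ⟨
    suc (e + t)      ≡⟨ +-suc e t ⟨
    e + suc t        ∎)
  where
  open ≤-Reasoning
  4s·s≡2s·2s : ∀ s → 4 * s * s ≡ 2 * s * (2 * s)
  4s·s≡2s·2s = solve-∀
  t<2s : t < 2 * s
  t<2s = *-cancelʳ-< (2 * s) t (2 * s) (begin-strict
    t * (2 * s)        ≤⟨ t·2s≤h·s ⟩
    h * s              <⟨ m<n+m (h * s) z<s ⟩
    s + h * s          ≡⟨ cong (_* s) 1+h≡4s ⟩
    4 * s * s          ≡⟨ 4s·s≡2s·2s s ⟩
    2 * s * (2 * s)    ∎)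

escapes-count : ∀ {h s} → suc h ≡ 4 * s → (A G : Fin h → Fin h → Bool) →
                (∀ x → 2 * s ≤ count (A x)) → (∀ y → count (G y) ≡ s) →
                2 * s ≤ count (escapes A G)
escapes-count {s = s} 1+h≡4s A G 2s≤∣A∣ ∣G∣≡s =
  few-trapped {s = s} 1+h≡4s (count+count-not (escapes A G))
              (trapped-count A G 2s≤∣A∣ (≤-reflexive ∘ ∣G∣≡s))

extend : ∀ {A : Set} → (ℕ → A) → ℕ → A → ℕ → A
extend a p z i with i <? p
... | yes _ = a i
... | no  _ = z

extend-< : ∀ {A : Set} (a : ℕ → A) {p} z {i} → i < p → extend a p z i ≡ a i
extend-< a {p} z {i} i<p with i <? p
... | yes _   = refl
... | no  i≮p = contradiction i<p i≮p

extend-≡ : ∀ {A : Set} (a : ℕ → A) p z → extend a p z p ≡ z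
extend-≡ a p z with p <? p
... | yes p<p = contradiction p<p (<-irrefl refl)
... | no  _   = refl

-- The sage at vertex j wears colour a (1 + j) and sees a j on his left and a (2 + j) on his
-- right; F j y z is the set of colours he names on seeing y and z. Positions 0 and n + 1 are
-- phantom neighbours of the end vertices, so they are read but never constrained.
module Fooling {h : ℕ} (F : ℕ → Fin h → Fin h → Fin h → Bool) where

  Fools : (ℕ → Fin h) → ℕ → Set
  Fools a k = ∀ {j} → j < k → ¬ T (F j (a j) (a (2 + j)) (a (1 + j)))

  Fools-cong : ∀ {a b k} → (∀ {i} → i ≤ suc k → a i ≡ b i) → Fools a k → Fools b k
  Fools-cong a≗b fools {j} j<k
    rewrite sym (a≗b (m<n⇒m≤1+n j<k))
          | sym (a≗b (s≤s j<k))
          | sym (a≗b (s≤s (<⇒≤ j<k))) = fools j<k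

  Fools-snoc : ∀ {a k} → Fools a k → ¬ T (F k (a k) (a (2 + k)) (a (1 + k))) → Fools a (suc k)
  Fools-snoc fools wrong j<1+k with m<1+n⇒m<n∨m≡n j<1+k
  ... | inj₁ j<k  = fools j<k
  ... | inj₂ refl = wrong

  foolable : ℕ → Fin h → Fin h → Bool
  foolable zero    z x = true
  foolable (suc k) z x = escapes (foolable k) (λ y x′ → F k y z x′) x

  foolable-sound : ∀ k {z x} → T (foolable k z x) →
                   ∃ λ a → a k ≡ x × a (suc k) ≡ z × Fools a k
  foolable-sound zero {z} {x} _ = (λ { zero → x ; (suc _) → z }) , refl , refl , λ ()
  foolable-sound (suc k) {z} {x} escape with toWitness escape
  ... | y , foolable-k-x-y , wrong with foolable-sound k foolable-k-x-y
  ... | a , refl , refl , fools =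
    b , extend-< a z ≤-refl , extend-≡ a (2 + k) z ,
    Fools-snoc (Fools-cong (sym ∘ extend-< a z ∘ s≤s) fools) wrong′
    where
    b : ℕ → Fin h
    b = extend a (2 + k) z
    wrong′ : ¬ T (F k (b k) (b (2 + k)) (b (1 + k)))
    wrong′ rewrite extend-< a z (m<n⇒m<1+n (n<1+n k))
                 | extend-≡ a (2 + k) z
                 | extend-< a z (n<1+n (suc k)) = wrong

  module _ {s} (1+h≡4s : suc h ≡ 4 * s) (∣F∣≡s : ∀ k y z → count (F k y z) ≡ s) where

    foolable-count : ∀ k z → 2 * s ≤ count (foolable k z)
    foolable-count zero    z = subst (2 * s ≤_) (sym (count-true h)) (1+h≡4s⇒2s≤h {s = s} 1+h≡4s)
    foolable-count (suc k) z =
      escapes-count 1+h≡4s (foolable k) (λ y x → F k y z x) (foolable-count k) (λ y → ∣F∣≡s k y z)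

    0<2s : 0 < 2 * s
    0<2s = ≤-trans (1+h≡4s⇒0<s {s = s} 1+h≡4s) (m≤m+n s _)

    fooling-colouring : ∀ k → ∃ λ a → Fools a k
    fooling-colouring k with count>0⇒∃ (foolable k z) (≤-trans 0<2s (foolable-count k z))
      where
      z : Fin h
      z = fromℕ< (≤-trans 0<2s (1+h≡4s⇒2s≤h {s = s} 1+h≡4s))
    ... | x , fooled with foolable-sound k fooled
    ... | a , _ , _ , fools = a , fools

module PathStrategy {m h : ℕ} {g : Fin (suc m) → ℕ}
                    (S : Strategy (PathGraph (suc m)) (λ _ → h) g) where
  open Strategy S

  vertex : ℕ → Fin (suc m)
  vertex k with k <? suc m
  ... | yes k<1+m = fromℕ< k<1+m
  ... | no  _     = Fin.zero

  vertex-toℕ : ∀ v → vertex (toℕ v) ≡ v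
  vertex-toℕ v with toℕ v <? suc m
  ... | yes v<1+m = fromℕ<-toℕ v v<1+m
  ... | no  v≮1+m = contradiction (toℕ<n v) v≮1+m

  -- Sage v only sees his neighbours, so an assignment giving y to v − 1 and z to v + 1 suffices.
  neighbourhood : Fin (suc m) → Fin h → Fin h → Assignment {suc m} (λ _ → h)
  neighbourhood v y z u with toℕ u ≟ suc (toℕ v)
  ... | yes _ = z
  ... | no  _ = y

  neighbourhood-right : ∀ {v y z u} → toℕ u ≡ suc (toℕ v) → neighbourhood v y z u ≡ z
  neighbourhood-right {v} {u = u} u≡1+v with toℕ u ≟ suc (toℕ v)
  ... | yes _   = refl
  ... | no  u≢1+v = contradiction u≡1+v u≢1+v

  neighbourhood-left : ∀ {v y z u} → toℕ v ≡ suc (toℕ u) → neighbourhood v y z u ≡ y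
  neighbourhood-left {v} {u = u} v≡1+u with toℕ u ≟ suc (toℕ v)
  ... | yes u≡1+v = contradiction (trans u≡1+v (cong suc v≡1+u)) (m≢1+n+m (toℕ u))
  ... | no  _     = refl

  table : ℕ → Fin h → Fin h → Fin h → Bool
  table k y z = lookup (guess (vertex k) (neighbourhood (vertex k) y z))

  count-table : ∀ k y z → count (table k y z) ≡ g (vertex k)
  count-table k y z = trans (sym (∣p∣≡count (guess (vertex k) _))) (size _ _)

  fooled⇒¬wins : (∃ λ a → Fooling.Fools table a (suc m)) → ¬ Wins S
  fooled⇒¬wins (a , fools) wins with wins (a ∘ suc ∘ toℕ)
  ... | v , guessed = fools (toℕ<n v) (subst (λ w → T (table′ w)) (sym (vertex-toℕ v)) v-right)
    where
    c : Assignment (λ _ → h)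
    c = a ∘ suc ∘ toℕ
    table′ : Fin (suc m) → Bool
    table′ w = lookup (guess w (neighbourhood w (a (toℕ v)) (a (2 + toℕ v)))) (c v)
    agree : ∀ u → Graph.Adj (PathGraph (suc m)) v u →
            neighbourhood v (a (toℕ v)) (a (2 + toℕ v)) u ≡ c u
    agree u (inj₁ u≡1+v) = trans (neighbourhood-right u≡1+v) (cong (a ∘ suc) (sym u≡1+v))
    agree u (inj₂ v≡1+u) = trans (neighbourhood-left v≡1+u) (cong a v≡1+u)
    v-right : T (table′ v)
    v-right = subst (λ p → T (lookup p (c v))) (sym (local v _ c agree))
                  (Equivalence.from T-≡ ([]=⇒lookup guessed))

  ¬wins : ∀ {s} → suc h ≡ 4 * s → (∀ v → g v ≡ s) → ¬ Wins S
  ¬wins {s} 1+h≡4s g≡s = fooled⇒¬wins (Fooling.fooling-colouring table {s = s} 1+h≡4s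
    (λ k y z → trans (count-table k y z) (g≡s (vertex k))) (suc m))

theorem3p3 : (s : ℕ) → 1 ≤ s → (n : ℕ) →
    Losing (PathGraph n) (λ _ → 4 * s ∸ 1) (λ _ → s)
theorem3p3 s 1≤s zero    (S , wins) with wins (λ ())
... | () , _
theorem3p3 s 1≤s (suc m) (S , wins) =
  PathStrategy.¬wins S {s} (m+[n∸m]≡n (≤-trans 1≤s (m≤m+n s (3 * s)))) (λ _ → refl) wins
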